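{- Let $\gamma_\xi$ be the GES with events $\{a,b,c\}$, empty initial causality, and $\mathrm{Add}=\{(a,b,c)\}$. There is no EBES $\xi$ with $\mathrm{Traces}(\xi)=\mathrm{Traces}(\gamma_\xi)$.
   Context: A GES is $\gamma=(E,\to,\mathrm{Add})$ with $E$ a set of events, $\to\subseteq E^2$, and $\mathrm{Add}\subseteq E^3$ such that $(a,c,t)\in\mathrm{Add}$ implies $\neg(c\to t)$ and $a\notin\{c,t\}$ ($a$ adds $c$ as a cause of $t$). Let $\mathrm{ic}(e)=\{e'\mid e'\to e\}$, $\mathrm{ac}(H,e)=\{e'\mid\exists a\in H.(a,e',e)\in\mathrm{Add}\}$. A trace of $\gamma$ is a sequence $e_1\cdots e_n$ of pairwise distinct events of $E$ with $\mathrm{ic}(e_i)\cup\mathrm{ac}(\{e_1,\dots,e_{i-1}\},e_i)\subseteq\{e_1,\dots,e_{i-1}\}$ for all $i$. An EBES is $\xi=(E,\rightsquigarrow,\mapsto)$ with $\rightsquigarrow\subseteq E^2$ irreflexive (disabling) and bundles $\mapsto\subseteq\mathcal P(E)\times E$ such that $X\mapsto e$ implies $e_1\rightsquigarrow e_2$ for all distinct $e_1,e_2\in X$. A trace of $\xi$ is a sequence $e_1\cdots e_n$ of pairwise distinct events such that $e_i\rightsquigarrow e_j$ implies $i<j$, and every bundle $X\mapsto e_i$ meets $\{e_1,\dots,e_{i-1}\}$. -}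

module Defs where

open import Level using (Level; 0ℓ) renaming (suc to lsuc)
open import Data.List using (List; length; lookup)
open import Data.List.Relation.Unary.Unique.Propositional using (Unique)
open import Data.Fin using (Fin; _<_)
open import Data.Product using (Σ; ∃; _×_; _,_)
open import Relation.Binary.PropositionalEquality using (_≡_; _≢_)
open import Relation.Nullary using (¬_)
open import Data.Empty using (⊥)

OccursBefore : {E : Set} (t : List E) → Fin (length t) → E → Set
OccursBefore t i e = Σ (Fin (length t)) λ j → (j < i) × (lookup t j ≡ e)

record GES (E : Set) : Set₁ where
  field
    cause : E → E → Set
    Add   : E → E → E → Set
    Add-wf : ∀ a c t → Add a c t → ¬ cause c t × a ≢ c × a ≢ t

open GES

GESTrace : {E : Set} → GES E → List E → Set
GESTrace γ t =
  Unique t ×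
  (∀ i e → cause γ e (lookup t i) → OccursBefore t i e) ×
  (∀ i e → (Σ _ λ a → OccursBefore t i a × Add γ a e (lookup t i))
         → OccursBefore t i e)

record EBES (E : Set) : Set₁ where
  field
    dis    : E → E → Set
    dis-irrefl : ∀ e → ¬ dis e e
    bundle : (E → Set) → E → Set
    bundle-wf : ∀ X e → bundle X e →
                ∀ e₁ e₂ → X e₁ → X e₂ → e₁ ≢ e₂ → dis e₁ e₂

open EBES

EBESTrace : {E : Set} → EBES E → List E → Set₁
EBESTrace ξ t =
  Unique t ×
  (∀ i j → dis ξ (lookup t i) (lookup t j) → i < j) ×
  (∀ i X → bundle ξ X (lookup t i) → Σ _ λ e → OccursBefore t i e × X e)

data Ev : Set where
  a b c : Ev

data NoCause : Ev → Ev → Set where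

data AddXi : Ev → Ev → Ev → Set where
  abc : AddXi a b c

γξ : GES Ev
γξ = record
  { cause  = NoCause
  ; Add    = AddXi
  ; Add-wf = λ { .a .b .c abc → (λ ()) , (λ ()) , (λ ()) }
  }

-- In an EBES, whether a sequence is a trace depends only on the bundles
-- pointing at its events and on the disabling between pairs of them.  Since a
-- and c are traces on their own, neither has a bundle, and since b a c is a
-- trace, c does not disable a; hence a c would be an EBES trace.  In γξ it is
-- not, because a has added b as a cause of c.
module Submission where

open import Defs
open import Data.List using (List; []; _∷_; lookup)
open import Data.Product using (Σ; _,_; _×_)
open import Relation.Nullary using (¬_)
open import Function.Bundles using (_⇔_; Equivalence)
open import Data.Fin using (zero; suc; _<_)
open import Data.Fin.Properties using (<-asym)
open import Data.Nat using (z≤n; s≤s)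
open import Data.List.Relation.Unary.All using ([]; _∷_)
open import Data.List.Relation.Unary.AllPairs using ([]; _∷_)
open import Relation.Binary.PropositionalEquality using (refl; _≢_)
open import Data.Empty using (⊥-elim)

module _ {E : Set} (ξ : EBES E) where
  open EBES ξ

  Unbundled : E → Set₁
  Unbundled e = ∀ X → ¬ bundle X e

  singleton-trace⇒unbundled : ∀ {e} → EBESTrace ξ (e ∷ []) → Unbundled e
  singleton-trace⇒unbundled (_ , _ , bundles-met) X X↦e with bundles-met zero X X↦e
  ... | _ , (_ , () , _) , _

  trace⇒¬dis-backwards : ∀ {t} → EBESTrace ξ t →
                         ∀ {i j} → i < j → ¬ dis (lookup t j) (lookup t i)
  trace⇒¬dis-backwards (_ , dis-ordered , _) i<j j⇝i = <-asym i<j (dis-ordered _ _ j⇝i)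

  pair-trace : ∀ {e₁ e₂} → e₁ ≢ e₂ → Unbundled e₁ → Unbundled e₂ → ¬ dis e₂ e₁ →
               EBESTrace ξ (e₁ ∷ e₂ ∷ [])
  pair-trace {e₁} {e₂} e₁≢e₂ unbundled₁ unbundled₂ ¬e₂⇝e₁ =
    ((e₁≢e₂ ∷ []) ∷ [] ∷ []) , dis-ordered , bundles-met
    where
    dis-ordered : ∀ i j → dis (lookup (e₁ ∷ e₂ ∷ []) i) (lookup (e₁ ∷ e₂ ∷ []) j) → i < j
    dis-ordered zero       zero       e₁⇝e₁ = ⊥-elim (dis-irrefl e₁ e₁⇝e₁)
    dis-ordered zero       (suc zero) _     = s≤s z≤n
    dis-ordered (suc zero) zero       e₂⇝e₁ = ⊥-elim (¬e₂⇝e₁ e₂⇝e₁)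
    dis-ordered (suc zero) (suc zero) e₂⇝e₂ = ⊥-elim (dis-irrefl e₂ e₂⇝e₂)

    bundles-met : ∀ i X → bundle X (lookup (e₁ ∷ e₂ ∷ []) i) →
                  Σ _ λ e → OccursBefore (e₁ ∷ e₂ ∷ []) i e × X e
    bundles-met zero       X X↦e₁ = ⊥-elim (unbundled₁ X X↦e₁)
    bundles-met (suc zero) X X↦e₂ = ⊥-elim (unbundled₂ X X↦e₂)

γξ-singleton-trace : ∀ e → GESTrace γξ (e ∷ [])
γξ-singleton-trace e = [] ∷ [] , (λ _ _ ()) , λ { zero _ (_ , (_ , () , _) , _) }

γξ-trace-bac : GESTrace γξ (b ∷ a ∷ c ∷ [])
γξ-trace-bac =
  ((λ ()) ∷ (λ ()) ∷ []) ∷ ((λ ()) ∷ []) ∷ [] ∷ [] , (λ _ _ ()) ,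
  λ { zero             _  (_ , (_ , () , _) , _)
    ; (suc zero)       _  (_ , _ , ())
    ; (suc (suc zero)) .b (.a , _ , abc) → zero , s≤s z≤n , refl }

¬γξ-trace-ac : ¬ GESTrace γξ (a ∷ c ∷ [])
¬γξ-trace-ac (_ , _ , added-causes-before) with
  added-causes-before (suc zero) b (a , (zero , s≤s z≤n , refl) , abc)
... | zero     , _     , ()
... | suc zero , s≤s () , _

lemma5p8 : ¬ (Σ (EBES Ev) λ ξ → ∀ (t : List Ev) → EBESTrace ξ t ⇔ GESTrace γξ t)
lemma5p8 (ξ , traces-agree) =
  ¬γξ-trace-ac (Equivalence.to (traces-agree (a ∷ c ∷ [])) ξ-trace-ac)
  where
  ξ-trace : ∀ {t} → GESTrace γξ t → EBESTrace ξ t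
  ξ-trace {t} = Equivalence.from (traces-agree t)

  ξ-trace-ac : EBESTrace ξ (a ∷ c ∷ [])
  ξ-trace-ac =
    pair-trace ξ (λ ())
      (singleton-trace⇒unbundled ξ (ξ-trace (γξ-singleton-trace a)))
      (singleton-trace⇒unbundled ξ (ξ-trace (γξ-singleton-trace c)))
      (trace⇒¬dis-backwards ξ (ξ-trace γξ-trace-bac)
         {suc zero} {suc (suc zero)} (s≤s (s≤s z≤n)))
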